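{- Let $P=\langle V,E,I,\mathcal T,E_o\rangle$ be a partially observable plant with no cycle of unobservable events, and let $p$ be a propositional formula over $V$. Then $p$ is diagnosable in $P$ in the sense of Sampath if and only if there exists $d\ge 0$ such that the alarm condition $\mathrm{BoundDel}(A, O p, d)$ is diagnosable in $P$.
   Context: A labeled transition system (LTS) is $S=\langle V,E,I,\mathcal T\rangle$: $V$ a finite set of state variables over a finite domain, $E$ a set of events, $I$ a propositional formula over $V$ (initial states), and for each $e\in E$ a formula $\mathcal T(e)$ over $V\cup V'$ ($V'$ the next-state copies). A state is an assignment to $V$. A trace is an infinite sequence $\sigma=s_0,e_0,s_1,e_1,s_2,\dots$ with $s_0\models I$ and $\langle s_k,s_{k+1}\rangle\models\mathcal T(e_k)$ for all $k$ (systems are deadlock free). $\sigma[k]=s_k$, and $\sigma^k=s_0,e_0,\dots,e_{k-1},s_k$. A partially observable plant additionally has a set $E_o\subseteq E$ of observable events. $\mathit{obs}(\sigma^k)$ is the sequence of those events among $e_0,\dots,e_{k-1}$ that lie in $E_o$ (in order). $\mathit{ObsPoint}(\sigma,i)$ holds iff $i>0$ and $e_{i-1}\in E_o$. $((\sigma_1,i),(\sigma_2,j))\in\mathit{ObsEq}$ iff ($\mathit{ObsPoint}(\sigma_1,i)$ iff $\mathit{ObsPoint}(\sigma_2,j)$) and $\mathit{obs}(\sigma_1^i)=\mathit{obs}(\sigma_2^j)$. Formulas are evaluated at positions of traces; propositional formulas at the state $s_i$; $\sigma,i\models O\beta$ iff $\sigma,j\models\beta$ for some $j\le i$. "No cycle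 of unobservable events": there is no reachable cycle of transitions all labeled by events in $E\setminus E_o$; hence there is a bound $d_u$ such that for every trace $\sigma$ and position $i$ there is $0\le k\le d_u$ with $\mathit{ObsPoint}(\sigma,i+k)$. Sampath diagnosability: $p$ is diagnosable in $P$ iff there exists $d$ such that for all traces $\sigma_1,\sigma_2$ of $P$ and all $i,l$ and all $k\ge i+d$: if $\sigma_1,i\models p$ and $\mathit{obs}(\sigma_2^l)=\mathit{obs}(\sigma_1^k)$, then there exists $j\le l$ with $\sigma_2,j\models p$. Diagnosability of $\mathrm{BoundDel}(A,\beta,d)$ in $P$: for all traces $\sigma_1$ of $P$ and $i$ with $\sigma_1,i\models\beta$ there exists $k$ with $i\le k\le i+d$ and $\mathit{ObsPoint}(\sigma_1,k)$ such that for all traces $\sigma_2$ of $P$ and all $l$, if $((\sigma_1,k),(\sigma_2,l))\in\mathit{ObsEq}$ then there exists $j$ with $l-d\le j\le l$ and $\sigma_2,j\models\beta$. -}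

module Defs where

open import Data.Nat using (ℕ; zero; suc; _+_; _≤_; _<_)
open import Data.Fin using (Fin)
open import Data.Bool using (Bool; true; false; not; _∧_; _∨_; if_then_else_)
open import Data.Sum using (_⊎_; inj₁; inj₂)
open import Data.Product using (Σ; ∃; ∃-syntax; _×_; _,_)
open import Data.List using (List; []; _∷_; [_]; _++_)
open import Data.Empty using (⊥)
open import Data.Unit using (⊤)
open import Relation.Binary.PropositionalEquality using (_≡_)
open import Function.Bundles using (_⇔_)

data Formula (X : Set) (dom : X → ℕ) : Set where
  atom  : (x : X) → Fin (dom x) → Formula X dom
  tt    : Formula X dom
  ¬f_   : Formula X dom → Formula X dom
  _∧f_  : Formula X dom → Formula X dom → Formula X dom
  _∨f_  : Formula X dom → Formula X dom → Formula X dom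

Assignment : (X : Set) (dom : X → ℕ) → Set
Assignment X dom = (x : X) → Fin (dom x)

open import Data.Fin using (_≟_)
open import Relation.Nullary.Decidable using (⌊_⌋)

eval : ∀ {X dom} → Formula X dom → Assignment X dom → Bool
eval (atom x c) s = ⌊ s x ≟ c ⌋
eval tt         s = true
eval (¬f φ)     s = not (eval φ s)
eval (φ ∧f ψ)   s = eval φ s ∧ eval ψ s
eval (φ ∨f ψ)   s = eval φ s ∨ eval ψ s

_⊨_ : ∀ {X dom} → Assignment X dom → Formula X dom → Set
s ⊨ φ = eval φ s ≡ true

-- Partially observable plants  P = ⟨V, E, I, T, E_o⟩.
-- V = Fin nV (each variable v has the finite domain Fin (dom v)),
-- E = Fin nE, E_o given by its characteristic function.

-- domain function for V ∪ V' (inj₁ v = v, inj₂ v = v')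
dom² : ∀ {n} → (Fin n → ℕ) → Fin n ⊎ Fin n → ℕ
dom² dom (inj₁ v) = dom v
dom² dom (inj₂ v) = dom v

record Plant : Set where
  field
    nV  : ℕ
    dom : Fin nV → ℕ
    nE  : ℕ
    I   : Formula (Fin nV) dom
    -- transition formula over V ∪ V' (inj₁ = current, inj₂ = next copy)
    T   : Fin nE → Formula (Fin nV ⊎ Fin nV) (dom² dom)
    Eo  : Fin nE → Bool

module _ (P : Plant) where
  open Plant P

  State : Set
  State = Assignment (Fin nV) dom

  Event : Set
  Event = Fin nE

  pairAssign : State → State → Assignment (Fin nV ⊎ Fin nV) (dom² dom)
  pairAssign s s' (inj₁ v) = s v
  pairAssign s s' (inj₂ v) = s' v

  Step : State → Event → State → Set
  Step s e s' = pairAssign s s' ⊨ T e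

  Observable : Event → Set
  Observable e = Eo e ≡ true

  data Reachable : State → Set where
    init : ∀ {s} → s ⊨ I → Reachable s
    step : ∀ {s e s'} → Reachable s → Step s e s' → Reachable s'

  DeadlockFree : Set
  DeadlockFree = ∀ s → Reachable s → ∃[ e ] ∃[ s' ] Step s e s'

  data UnobsPath : ℕ → State → State → Set where
    []  : ∀ {s} → UnobsPath zero s s
    _∷_ : ∀ {n s e s' s''} → (Step s e s' × Eo e ≡ false)
        → UnobsPath n s' s'' → UnobsPath (suc n) s s''

  NoUnobsCycle : Set
  NoUnobsCycle = ∀ n s → Reachable s → UnobsPath (suc n) s s → ⊥

  record Trace : Set where
    field
      st    : ℕ → State
      ev    : ℕ → Event
      start : st 0 ⊨ I
      trans : ∀ k → Step (st k) (ev k) (st (suc k))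
  open Trace public

  obs : Trace → ℕ → List Event
  obs σ zero    = []
  obs σ (suc k) = obs σ k ++ (if Eo (ev σ k) then [ ev σ k ] else [])

  ObsPoint : Trace → ℕ → Set
  ObsPoint σ zero    = ⊥
  ObsPoint σ (suc i) = Observable (ev σ i)

  ObsEq : Trace → ℕ → Trace → ℕ → Set
  ObsEq σ₁ i σ₂ j = (ObsPoint σ₁ i ⇔ ObsPoint σ₂ j) × obs σ₁ i ≡ obs σ₂ j

  data TFormula : Set where
    prop : Formula (Fin nV) dom → TFormula
    O    : TFormula → TFormula

  _,_⊨ᵗ_ : Trace → ℕ → TFormula → Set
  σ , i ⊨ᵗ prop φ = st σ i ⊨ φ
  σ , i ⊨ᵗ O β    = ∃[ j ] (j ≤ i × σ , j ⊨ᵗ β)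

  SampathDiagnosable : Formula (Fin nV) dom → Set
  SampathDiagnosable p =
    ∃[ d ] ∀ (σ₁ σ₂ : Trace) (i l k : ℕ) → i + d ≤ k →
      σ₁ , i ⊨ᵗ prop p → obs σ₂ l ≡ obs σ₁ k →
      ∃[ j ] (j ≤ l × σ₂ , j ⊨ᵗ prop p)

  -- diagnosability of the alarm condition BoundDel(A, β, d)
  -- (the condition  l - d ≤ j  is written  l ≤ j + d  over ℕ)
  BoundDelDiagnosable : TFormula → ℕ → Set
  BoundDelDiagnosable β d =
    ∀ (σ₁ : Trace) (i : ℕ) → σ₁ , i ⊨ᵗ β →
      ∃[ k ] (i ≤ k × k ≤ i + d × ObsPoint σ₁ k ×
        (∀ (σ₂ : Trace) (l : ℕ) → ObsEq σ₁ k σ₂ l →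
          ∃[ j ] (l ≤ j + d × j ≤ l × σ₂ , j ⊨ᵗ β)))

-- Sampath's delay is counted from the fault, while a bounded-delay alarm must be raised at an
-- observation point, so the two delays differ by at most the length of a run of unobservable
-- events. Such a run is shorter than the number of states: a longer one repeats a state by
-- pigeonhole and so closes a reachable unobservable cycle. Conversely, if an alarm is raised at
-- an observation point k of one trace, it is also raised in any other trace at the point whose
-- observation equals that of k, and such a point exists once that trace's observation extends
-- the one at k.
module Submission where

open import Defs
open import Data.Product using (∃-syntax)
open import Function.Bundles using (_⇔_)
open import Data.Fin using (Fin)

import Data.Bool as Bool
open import Data.Bool using (true; false; not; _∧_; _∨_)
open import Data.Bool.Properties using (¬-not)
open import Data.Empty using (⊥-elim)
open import Data.Fin as Fin using (combine; toℕ)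
open import Data.Fin.Properties using (combine-injective; pigeonhole; toℕ<n)
open import Data.List using (List; []; _∷_; [_]; _++_; initLast; _∷ʳ′_)
open import Data.List.Properties using (++-assoc; ++-identityʳ; ∷ʳ-injectiveˡ)
open import Data.Nat using (ℕ; zero; suc; _+_; _*_; _≤_; _<_; _≤′_; ≤′-refl; ≤′-step; s≤s)
open import Data.Nat.Properties
open import Data.Product using (_×_; _,_; proj₁; proj₂)
open import Data.Sum using (inj₁; inj₂)
open import Function.Bundles using (mk⇔)
open import Relation.Binary.PropositionalEquality
  as ≡ using (_≡_; refl; sym; cong; cong₂; subst; module ≡-Reasoning)
open import Relation.Nullary using (¬_; yes; no)

∣Assignment∣ : (n : ℕ) → (Fin n → ℕ) → ℕ
∣Assignment∣ zero    dom = 1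
∣Assignment∣ (suc n) dom = dom Fin.zero * ∣Assignment∣ n (λ x → dom (Fin.suc x))

encode : ∀ {n dom} → Assignment (Fin n) dom → Fin (∣Assignment∣ n dom)
encode {zero}  s = Fin.zero
encode {suc n} s = combine (s Fin.zero) (encode (λ x → s (Fin.suc x)))

encode-injective : ∀ {n dom} (s s' : Assignment (Fin n) dom) →
  encode s ≡ encode s' → ∀ x → s x ≡ s' x
encode-injective {suc n} s s' eq Fin.zero    = proj₁ (combine-injective (s Fin.zero) _ (s' Fin.zero) _ eq)
encode-injective {suc n} {dom} s s' eq (Fin.suc x) =
  encode-injective {dom = λ y → dom (Fin.suc y)} (λ y → s (Fin.suc y)) (λ y → s' (Fin.suc y))
    (proj₂ (combine-injective (s Fin.zero) _ (s' Fin.zero) _ eq)) x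

eval-cong : ∀ {X dom} (φ : Formula X dom) {s s' : Assignment X dom} →
  (∀ x → s x ≡ s' x) → eval φ s ≡ eval φ s'
eval-cong (atom x c) s≐s' rewrite s≐s' x = refl
eval-cong tt         s≐s' = refl
eval-cong (¬f φ)     s≐s' = cong not (eval-cong φ s≐s')
eval-cong (φ ∧f ψ)   s≐s' = cong₂ _∧_ (eval-cong φ s≐s') (eval-cong ψ s≐s')
eval-cong (φ ∨f ψ)   s≐s' = cong₂ _∨_ (eval-cong φ s≐s') (eval-cong ψ s≐s')

module _ (P : Plant) where
  open Plant P

  ∣State∣ : ℕ
  ∣State∣ = ∣Assignment∣ nV dom

  Step-congʳ : ∀ {s e s' s''} → (∀ x → s' x ≡ s'' x) → Step P s e s' → Step P s e s''
  Step-congʳ {s} {e} {s'} {s''} s'≐s'' = ≡.trans (sym (eval-cong (T e) pairs≐))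
    where
    pairs≐ : ∀ x → pairAssign P s s' x ≡ pairAssign P s s'' x
    pairs≐ (inj₁ v) = refl
    pairs≐ (inj₂ v) = s'≐s'' v

  _∷ʳ_ : ∀ {n s s' e s''} → UnobsPath P n s s' → Step P s' e s'' × Eo e ≡ false →
    UnobsPath P (suc n) s s''
  []       ∷ʳ final = final ∷ []
  (u ∷ us) ∷ʳ final = u ∷ (us ∷ʳ final)

  st-reachable : (σ : Trace P) (k : ℕ) → Reachable P (st σ k)
  st-reachable σ zero    = init (start σ)
  st-reachable σ (suc k) = step (st-reachable σ k) (Trace.trans σ k)

  unobsSegment : (σ : Trace P) (m len : ℕ) → (∀ t → t < len → Eo (ev σ (t + m)) ≡ false) →
    UnobsPath P len (st σ m) (st σ (len + m))
  unobsSegment σ m zero      unobs = []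
  unobsSegment σ m (suc len) unobs =
    unobsSegment σ m len (λ t t<len → unobs t (m<n⇒m<1+n t<len))
      ∷ʳ (Trace.trans σ (len + m) , unobs len ≤-refl)

  ¬long-unobsRun : NoUnobsCycle P → (σ : Trace P) (n : ℕ) →
    ¬ (∀ t → t < ∣State∣ → Eo (ev σ (t + n)) ≡ false)
  ¬long-unobsRun noCycle σ n unobs
    with i , j , i<j , same-code ← pigeonhole ≤-refl (λ x → encode (st σ (toℕ x + n)))
    with c , i+1+c≡j ← m≤n⇒∃[o]m+o≡n i<j
    = noCycle c (st σ m) (st-reachable σ m) (unobsSegment σ m c unobsBefore ∷ʳ (closing , unobsAt c ≤-refl))
    where
    a = toℕ i
    m = a + n

    j≡ : toℕ j ≡ suc c + a
    j≡ = ≡.trans (sym i+1+c≡j) (≡.trans (+-comm (suc a) c) (+-suc c a))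

    unobsAt : ∀ t → t < suc c → Eo (ev σ (t + m)) ≡ false
    unobsAt t t<c+1 = subst (λ q → Eo (ev σ q) ≡ false) (+-assoc t a n)
      (unobs (t + a) (≤-trans (+-monoˡ-≤ a t<c+1) (subst (_≤ ∣State∣) j≡ (≤-pred (toℕ<n j)))))

    unobsBefore : ∀ t → t < c → Eo (ev σ (t + m)) ≡ false
    unobsBefore t t<c = unobsAt t (m<n⇒m<1+n t<c)

    returns : ∀ x → st σ (suc c + m) x ≡ st σ m x
    returns = encode-injective _ _ (begin
      encode (st σ (suc c + m))       ≡⟨ cong (λ q → encode (st σ q)) (+-assoc (suc c) a n) ⟨
      encode (st σ (suc c + a + n))   ≡⟨ cong (λ q → encode (st σ (q + n))) j≡ ⟨
      encode (st σ (toℕ j + n))       ≡⟨ same-code ⟨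
      encode (st σ m)                 ∎)
      where open ≡-Reasoning

    closing : Step P (st σ (c + m)) (ev σ (c + m)) (st σ m)
    closing = Step-congʳ returns (Trace.trans σ (c + m))

  obsPoint-within : NoUnobsCycle P → (σ : Trace P) (n : ℕ) →
    ∃[ k ] (n < k × k ≤ n + ∣State∣ × ObsPoint P σ k)
  obsPoint-within noCycle σ n with anyUpTo? (λ t → Eo (ev σ (t + n)) Bool.≟ true) ∣State∣
  ... | yes (t , t<∣State∣ , observable) =
    suc (t + n) , s≤s (m≤n+m n t) , ≤-trans (+-monoˡ-≤ n t<∣State∣) (≤-reflexive (+-comm ∣State∣ n)) , observable
  ... | no none =
    ⊥-elim (¬long-unobsRun noCycle σ n (λ t t<∣State∣ → ¬-not (λ observable → none (t , t<∣State∣ , observable))))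

  obs-observable : (σ : Trace P) (k : ℕ) → Observable P (ev σ k) →
    obs P σ (suc k) ≡ obs P σ k ++ [ ev σ k ]
  obs-observable σ k observable rewrite observable = refl

  obs-prefix : (σ : Trace P) {k k' : ℕ} → k ≤′ k' → ∃[ rest ] (obs P σ k' ≡ obs P σ k ++ rest)
  obs-prefix σ ≤′-refl = [] , sym (++-identityʳ _)
  obs-prefix σ {k} (≤′-step {k'} k≤′k') =
    let rest , ext = obs-prefix σ k≤′k'
        new = Bool.if Eo (ev σ k') then [ ev σ k' ] else []
    in rest ++ new , ≡.trans (cong (_++ new) ext) (++-assoc (obs P σ k) rest new)

  obs-prefix⇒obsPoint : (σ : Trace P) (l : ℕ) (xs : List (Event P)) (e : Event P) (ys : List (Event P)) →
    obs P σ l ≡ xs ++ e ∷ ys → ∃[ l' ] (l' ≤ l × ObsPoint P σ l' × obs P σ l' ≡ xs ++ [ e ])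
  obs-prefix⇒obsPoint σ zero    []       e ys ()
  obs-prefix⇒obsPoint σ zero    (_ ∷ _)  e ys ()
  obs-prefix⇒obsPoint σ (suc l) xs e ys eq with Eo (ev σ l) in observable
  ... | false =
    let l' , l'≤l , rest = obs-prefix⇒obsPoint σ l xs e ys (≡.trans (sym (++-identityʳ _)) eq)
    in l' , m≤n⇒m≤1+n l'≤l , rest
  ... | true with initLast ys
  ...   | [] = suc l , ≤-refl , observable , ≡.trans (obs-observable σ l observable) eq
  ...   | ys' ∷ʳ′ y =
    let l' , l'≤l , rest = obs-prefix⇒obsPoint σ l xs e ys'
          (∷ʳ-injectiveˡ (obs P σ l) (xs ++ e ∷ ys') (≡.trans eq (sym (++-assoc xs (e ∷ ys') [ y ]))))
    in l' , m≤n⇒m≤1+n l'≤l , rest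

  obsEq-before : (σ₁ σ₂ : Trace P) {k k' l : ℕ} → ObsPoint P σ₁ k → k ≤ k' →
    obs P σ₂ l ≡ obs P σ₁ k' → ∃[ l' ] (l' ≤ l × ObsEq P σ₁ k σ₂ l')
  obsEq-before σ₁ σ₂ {zero} ()
  obsEq-before σ₁ σ₂ {suc k} {k'} {l} observable k≤k' same
    with rest , k'-extends ← obs-prefix σ₁ (≤⇒≤′ k≤k')
    = let l' , l'≤l , observable₂ , same' = obs-prefix⇒obsPoint σ₂ l (obs P σ₁ k) (ev σ₁ k) rest extends
      in l' , l'≤l , mk⇔ (λ _ → observable₂) (λ _ → observable) , ≡.trans obs-at-k (sym same')
    where
    open ≡-Reasoning
    obs-at-k = obs-observable σ₁ k observable
    extends : obs P σ₂ l ≡ obs P σ₁ k ++ ev σ₁ k ∷ rest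
    extends = begin
      obs P σ₂ l                           ≡⟨ same ⟩
      obs P σ₁ k'                          ≡⟨ k'-extends ⟩
      obs P σ₁ (suc k) ++ rest             ≡⟨ cong (_++ rest) obs-at-k ⟩
      (obs P σ₁ k ++ [ ev σ₁ k ]) ++ rest  ≡⟨ ++-assoc (obs P σ₁ k) [ ev σ₁ k ] rest ⟩
      obs P σ₁ k ++ ev σ₁ k ∷ rest         ∎

  sampath⇒boundDel : NoUnobsCycle P → (p : Formula (Fin nV) dom) →
    SampathDiagnosable P p → ∃[ d ] BoundDelDiagnosable P (O (prop p)) d
  sampath⇒boundDel noCycle p (D , diagnose) = D + ∣State∣ , alarm
    where
    alarm : BoundDelDiagnosable P (O (prop p)) (D + ∣State∣)
    alarm σ₁ i (j₀ , j₀≤i , pj₀)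
      with k , i+D<k , k≤i+D+∣State∣ , observable ← obsPoint-within noCycle σ₁ (i + D)
      = k , ≤-trans (m≤m+n i D) (<⇒≤ i+D<k) , subst (k ≤_) (+-assoc i D ∣State∣) k≤i+D+∣State∣ , observable ,
        λ σ₂ l (_ , same) → l , m≤m+n l _ , ≤-refl , diagnose σ₁ σ₂ j₀ l k j₀+D≤k pj₀ (sym same)
      where
      j₀+D≤k : j₀ + D ≤ k
      j₀+D≤k = ≤-trans (+-monoˡ-≤ D j₀≤i) (<⇒≤ i+D<k)

  boundDel⇒sampath : (p : Formula (Fin nV) dom) →
    ∃[ d ] BoundDelDiagnosable P (O (prop p)) d → SampathDiagnosable P p
  boundDel⇒sampath p (d , alarm) = d , diagnose
    where
    diagnose : ∀ (σ₁ σ₂ : Trace P) (i l k' : ℕ) → i + d ≤ k' → st σ₁ i ⊨ p →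
      obs P σ₂ l ≡ obs P σ₁ k' → ∃[ j ] (j ≤ l × st σ₂ j ⊨ p)
    diagnose σ₁ σ₂ i l k' i+d≤k' pi same =
      let k , _ , k≤i+d , observable , raised = alarm σ₁ i (i , ≤-refl , pi)
          l' , l'≤l , obsEq = obsEq-before σ₁ σ₂ observable (≤-trans k≤i+d i+d≤k') same
          j , _ , j≤l' , j' , j'≤j , pj' = raised σ₂ l' obsEq
      in j' , ≤-trans j'≤j (≤-trans j≤l' l'≤l) , pj'

-- Traces are infinite by definition.
theorem3p7 : (P : Plant) → DeadlockFree P → NoUnobsCycle P →
    (p : Formula (Fin (Plant.nV P)) (Plant.dom P)) →
    SampathDiagnosable P p ⇔ (∃[ d ] BoundDelDiagnosable P (O (prop p)) d)
theorem3p7 P _ noCycle p = mk⇔ (sampath⇒boundDel P noCycle p) (boundDel⇒sampath P p)
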